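{- Say a partition $\lambda$ with column heights $c_1\ge c_2\ge\cdots\ge c_j>0$ (and $c_{j+1}=0$) has the stair-step property if $c_i-1\le c_{i+1}$ for all $1\le i\le j$ (equivalently, consecutive columns differ in height by at most one and the last column has height $1$; the empty partition has this property), and in that case define its landing number $L(\lambda)=|\{i : 1\le i<j,\ c_i=c_{i+1}\}|$. Let $\psi_2$ be the partial map on partitions defined by: if $\lambda$ has first (bottom) row of length $j=\lambda_1$ and first column of height $k$, then $\psi_2(\lambda)$ is defined iff $j\le k+3$, and is the partition with row lengths $k+2,\lambda_1-1,\dots,\lambda_k-1$ (zeros discarded), i.e. remove the first column, add two boxes to it, and insert it as a new first row. If $\lambda$ has the stair-step property with $L(\lambda)\le 2$, then $\psi_2(\lambda)$ is defined, has the stair-step property, and satisfies $L(\psi_2(\lambda))\le 2$.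
   Context: Partitions are drawn as southwest-justified Young diagrams; $\lambda_r$ is the length of the $r$-th row from the bottom, and columns are indexed from left to right. -}

module Defs where

open import Data.Nat using (ℕ; zero; suc; _+_; _≤_; _<_; _≥_; _≤?_; _≟_)
open import Data.List using (List; []; _∷_; length; map; filter; upTo)
open import Data.List.Relation.Unary.All using (All)
open import Data.List.Relation.Unary.Linked using (Linked)
open import Data.Maybe using (Maybe; just; nothing)
open import Data.Unit using (⊤)
open import Data.Product using (_×_)
open import Relation.Nullary using (yes; no)

-- A partition is given by its list of row lengths, bottom row first:
-- λ₁ ≥ λ₂ ≥ ... > 0 (zeros are not stored).
IsPartition : List ℕ → Set
IsPartition rs = Linked _≥_ rs × All (0 <_) rs

firstRow : List ℕ → ℕ
firstRow []      = 0
firstRow (r ∷ _) = r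

-- column heights c₁ ≥ c₂ ≥ ... ≥ c_j > 0, j = λ₁ :
-- c_i = #{ r : λ_r ≥ i },  i = 1 .. λ₁
columns : List ℕ → List ℕ
columns rs = map (λ i → length (filter (suc i ≤?_) rs)) (upTo (firstRow rs))

-- stair-step property of a list of column heights c₁,...,c_j (c_{j+1} = 0):
-- c_i - 1 ≤ c_{i+1} for all 1 ≤ i ≤ j, written as c_i ≤ c_{i+1} + 1.
StairStepCols : List ℕ → Set
StairStepCols []            = ⊤
StairStepCols (c ∷ [])      = c ≤ 1
StairStepCols (c ∷ d ∷ cs)  = c ≤ suc d × StairStepCols (d ∷ cs)

StairStep : List ℕ → Set
StairStep rs = StairStepCols (columns rs)

eqBit : ℕ → ℕ → ℕ
eqBit c d with c ≟ d
... | yes _ = 1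
... | no  _ = 0

landingCols : List ℕ → ℕ
landingCols []           = 0
landingCols (c ∷ [])     = 0
landingCols (c ∷ d ∷ cs) = eqBit c d + landingCols (d ∷ cs)

landing : List ℕ → ℕ
landing rs = landingCols (columns rs)

shrinkRows : List ℕ → List ℕ
shrinkRows []            = []
shrinkRows (zero ∷ rs)   = shrinkRows rs
shrinkRows (suc r ∷ rs)  = r ∷ shrinkRows rs

ψ₂ : List ℕ → Maybe (List ℕ)
ψ₂ rs with firstRow rs ≤? length rs + 3
... | yes _ = just (suc (suc (length rs)) ∷ shrinkRows rs)
... | no  _ = nothing

-- Write c_1 ≥ ... ≥ c_j > 0 for the columns.  In a stair-step partition every step c_i → c_{i+1}
-- is either a landing (c_i = c_{i+1}) or a drop by one, so c_1 + L = c_j + (j - 1).  As c_1 = k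
-- (the number of rows) and c_j ≥ 1, this gives j ≤ k + L ≤ k + 2, so ψ₂(λ) is defined.  The
-- columns of ψ₂(λ) are 1 + c_2, ..., 1 + c_{k+3}, where c_{k+3} = 0: they are stair-step, and the
-- same identity gives (1 + c_2) + L(ψ₂ λ) = 1 + (k + 1); since k = c_1 ≤ 1 + c_2, L(ψ₂ λ) ≤ 2.
module Submission where

open import Defs
open import Data.Nat using (ℕ; zero; suc; _+_; _≤_; _<_; _≥_; _≤?_; _≟_; z≤n; s≤s)
open import Data.Nat.Properties
open import Data.List using (List; []; _∷_; length; filter; applyUpTo)
open import Data.List.Properties using (map-upTo; filter-accept; filter-reject; filter-all; filter-none)
open import Data.List.Relation.Unary.All as All using (All)
open import Data.List.Relation.Unary.Linked using (Linked)
open import Data.List.Relation.Unary.Linked.Properties using (Linked⇒All)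
open import Data.Maybe using (just)
open import Data.Product using (Σ; _×_; _,_)
open import Data.Empty using (⊥-elim)
open import Relation.Nullary using (yes; no; ¬_)
open import Relation.Binary.PropositionalEquality

Antitone : (ℕ → ℕ) → Set
Antitone g = ∀ i → g (suc i) ≤ g i

Stair : (ℕ → ℕ) → Set
Stair g = ∀ i → g i ≤ suc (g (suc i))

StairStepCols-applyUpTo⁻ : ∀ n (g : ℕ → ℕ) → (∀ i → n ≤ i → g i ≡ 0) →
  StairStepCols (applyUpTo g n) → Stair g
StairStepCols-applyUpTo⁻ zero g vanish _ i = subst (_≤ suc (g (suc i))) (sym (vanish i z≤n)) z≤n
StairStepCols-applyUpTo⁻ (suc zero) g vanish g0≤1 zero =
  subst (λ x → g 0 ≤ suc x) (sym (vanish 1 ≤-refl)) g0≤1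
StairStepCols-applyUpTo⁻ (suc zero) g vanish _ (suc i) =
  subst (_≤ suc (g (suc (suc i)))) (sym (vanish (suc i) (s≤s z≤n))) z≤n
StairStepCols-applyUpTo⁻ (suc (suc n)) g vanish (g0≤ , _) zero = g0≤
StairStepCols-applyUpTo⁻ (suc (suc n)) g vanish (_ , rest) (suc i) =
  StairStepCols-applyUpTo⁻ (suc n) (λ i → g (suc i)) (λ i n≤i → vanish (suc i) (s≤s n≤i)) rest i

StairStepCols-applyUpTo⁺ : ∀ n (g : ℕ → ℕ) → Stair g → g n ≤ 1 →
  StairStepCols (applyUpTo g (suc n))
StairStepCols-applyUpTo⁺ zero g _ gn≤1 = gn≤1
StairStepCols-applyUpTo⁺ (suc n) g stair gn≤1 =
  stair 0 , StairStepCols-applyUpTo⁺ n (λ i → g (suc i)) (λ i → stair (suc i)) gn≤1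

+-eqBit≡suc : ∀ {c d} → d ≤ c → c ≤ suc d → c + eqBit c d ≡ suc d
+-eqBit≡suc {c} {d} d≤c c≤1+d with c ≟ d
... | yes refl = +-comm c 1
... | no c≢d = trans (+-identityʳ c) (≤-antisym c≤1+d (≤∧≢⇒< d≤c (λ d≡c → c≢d (sym d≡c))))

landingCols-applyUpTo : ∀ n (g : ℕ → ℕ) → Antitone g → Stair g →
  g 0 + landingCols (applyUpTo g (suc n)) ≡ g n + n
landingCols-applyUpTo zero g _ _ = refl
landingCols-applyUpTo (suc n) g antitone stair = begin
  g 0 + (eqBit (g 0) (g 1) + L)  ≡⟨ sym (+-assoc (g 0) (eqBit (g 0) (g 1)) L) ⟩
  g 0 + eqBit (g 0) (g 1) + L    ≡⟨ cong (_+ L) (+-eqBit≡suc (antitone 0) (stair 0)) ⟩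
  suc (g 1 + L)                  ≡⟨ cong suc (landingCols-applyUpTo n (λ i → g (suc i))
                                      (λ i → antitone (suc i)) (λ i → stair (suc i))) ⟩
  suc (g (suc n) + n)            ≡⟨ sym (+-suc (g (suc n)) n) ⟩
  g (suc n) + suc n              ∎
  where
    open ≡-Reasoning
    L : ℕ
    L = landingCols (applyUpTo (λ i → g (suc i)) (suc n))

applyUpTo-cong< : ∀ n (f g : ℕ → ℕ) → (∀ i → i < n → f i ≡ g i) → applyUpTo f n ≡ applyUpTo g n
applyUpTo-cong< zero f g _ = refl
applyUpTo-cong< (suc n) f g f≡g = cong₂ _∷_ (f≡g 0 (s≤s z≤n))
  (applyUpTo-cong< n (λ i → f (suc i)) (λ i → g (suc i)) (λ i i<n → f≡g (suc i) (s≤s i<n)))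

-- columnHeight rs i is the height c_{i+1} of the (i+1)-st column.
columnHeight : List ℕ → ℕ → ℕ
columnHeight rs i = length (filter (suc i ≤?_) rs)

columns≡applyUpTo : ∀ rs → columns rs ≡ applyUpTo (columnHeight rs) (firstRow rs)
columns≡applyUpTo rs = map-upTo (columnHeight rs) (firstRow rs)

columnHeight-accept : ∀ r rs i → i < r → columnHeight (r ∷ rs) i ≡ suc (columnHeight rs i)
columnHeight-accept r rs i i<r = cong length (filter-accept (suc i ≤?_) i<r)

columnHeight-reject : ∀ r rs i → ¬ i < r → columnHeight (r ∷ rs) i ≡ columnHeight rs i
columnHeight-reject r rs i i≮r = cong length (filter-reject (suc i ≤?_) i≮r)

columnHeight-shrinkRows : ∀ rs i → columnHeight (shrinkRows rs) i ≡ columnHeight rs (suc i)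
columnHeight-shrinkRows [] i = refl
columnHeight-shrinkRows (zero ∷ rs) i = columnHeight-shrinkRows rs i
columnHeight-shrinkRows (suc r ∷ rs) i with suc i ≤? r
... | yes i<r = trans (columnHeight-accept r (shrinkRows rs) i i<r)
  (trans (cong suc (columnHeight-shrinkRows rs i))
         (sym (columnHeight-accept (suc r) rs (suc i) (s≤s i<r))))
... | no i≮r = trans (columnHeight-reject r (shrinkRows rs) i i≮r)
  (trans (columnHeight-shrinkRows rs i)
         (sym (columnHeight-reject (suc r) rs (suc i) (λ { (s≤s i<r) → i≮r i<r }))))

columnHeight-antitone : ∀ rs → Antitone (columnHeight rs)
columnHeight-antitone [] i = z≤n
columnHeight-antitone (r ∷ rs) i with suc (suc i) ≤? r | suc i ≤? r
... | yes i+1<r | yes i<r = subst₂ _≤_ (sym (columnHeight-accept r rs (suc i) i+1<r))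
  (sym (columnHeight-accept r rs i i<r)) (s≤s (columnHeight-antitone rs i))
... | yes i+1<r | no i≮r = ⊥-elim (i≮r (≤-trans (n≤1+n _) i+1<r))
... | no i+1≮r | yes i<r = subst₂ _≤_ (sym (columnHeight-reject r rs (suc i) i+1≮r))
  (sym (columnHeight-accept r rs i i<r)) (m≤n⇒m≤1+n (columnHeight-antitone rs i))
... | no i+1≮r | no i≮r = subst₂ _≤_ (sym (columnHeight-reject r rs (suc i) i+1≮r))
  (sym (columnHeight-reject r rs i i≮r)) (columnHeight-antitone rs i)

columnHeight-zero : ∀ rs → All (0 <_) rs → columnHeight rs 0 ≡ length rs
columnHeight-zero rs positive = cong length (filter-all (1 ≤?_) positive)

columnHeight-beyond : ∀ {rs i} → Linked _≥_ rs → firstRow rs ≤ i → columnHeight rs i ≡ 0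
columnHeight-beyond {[]} _ _ = refl
columnHeight-beyond {r ∷ rs} {i} sorted r≤i = cong length (filter-none (suc i ≤?_)
  (All.map (λ s≤r → ≤⇒≯ (≤-trans s≤r r≤i)) (Linked⇒All (λ p q → ≤-trans q p) ≤-refl sorted)))

StairStep⇒Stair : ∀ rs → Linked _≥_ rs → StairStep rs → Stair (columnHeight rs)
StairStep⇒Stair rs sorted stairStep = StairStepCols-applyUpTo⁻ (firstRow rs) (columnHeight rs)
  (λ i → columnHeight-beyond sorted) (subst StairStepCols (columns≡applyUpTo rs) stairStep)

landing≡landingCols-applyUpTo : ∀ rs →
  landing rs ≡ landingCols (applyUpTo (columnHeight rs) (firstRow rs))
landing≡landingCols-applyUpTo rs = cong landingCols (columns≡applyUpTo rs)

firstRow≤length+landing : ∀ rs → IsPartition rs → Stair (columnHeight rs) →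
  firstRow rs ≤ length rs + landing rs
firstRow≤length+landing [] _ _ = z≤n
firstRow≤length+landing (zero ∷ rs) (_ , () All.∷ _) _
firstRow≤length+landing (suc n ∷ rs) (_ , positive) stair = begin
  suc n                           ≤⟨ +-monoˡ-≤ n topColumn≥1 ⟩
  g n + n                         ≡⟨ sym (landingCols-applyUpTo n g
                                       (columnHeight-antitone (suc n ∷ rs)) stair) ⟩
  g 0 + landingCols (applyUpTo g (suc n))
                                  ≡⟨ cong₂ _+_ (columnHeight-zero (suc n ∷ rs) positive)
                                       (sym (landing≡landingCols-applyUpTo (suc n ∷ rs))) ⟩
  length (suc n ∷ rs) + landing (suc n ∷ rs) ∎
  where
    open ≤-Reasoning
    g : ℕ → ℕ
    g = columnHeight (suc n ∷ rs)
    topColumn≥1 : 1 ≤ g n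
    topColumn≥1 = subst (1 ≤_) (sym (columnHeight-accept (suc n) rs n ≤-refl)) (s≤s z≤n)

columns-∷-shrinkRows : ∀ k rs →
  columns (k ∷ shrinkRows rs) ≡ applyUpTo (λ i → suc (columnHeight rs (suc i))) k
columns-∷-shrinkRows k rs = trans (columns≡applyUpTo (k ∷ shrinkRows rs))
  (applyUpTo-cong< k _ _ (λ i i<k → trans (columnHeight-accept k (shrinkRows rs) i i<k)
                                           (cong suc (columnHeight-shrinkRows rs i))))

module _ (k : ℕ) {rs : List ℕ} (sorted : Linked _≥_ rs) (stair : Stair (columnHeight rs))
         (firstRow≤1+k : firstRow rs ≤ suc k) where

  private
    h : ℕ → ℕ
    h i = suc (columnHeight rs (suc i))

    h-beyond : h k ≡ 1
    h-beyond = cong suc (columnHeight-beyond sorted firstRow≤1+k)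

  StairStep-∷-shrinkRows : StairStep (suc k ∷ shrinkRows rs)
  StairStep-∷-shrinkRows = subst StairStepCols (sym (columns-∷-shrinkRows (suc k) rs))
    (StairStepCols-applyUpTo⁺ k h (λ i → s≤s (stair (suc i))) (≤-reflexive h-beyond))

  landing-∷-shrinkRows : columnHeight rs 0 + landing (suc k ∷ shrinkRows rs) ≤ suc k
  landing-∷-shrinkRows = begin
    columnHeight rs 0 + landing (suc k ∷ shrinkRows rs)
                  ≡⟨ cong (λ cs → columnHeight rs 0 + landingCols cs)
                          (columns-∷-shrinkRows (suc k) rs) ⟩
    columnHeight rs 0 + L  ≤⟨ +-monoˡ-≤ L (stair 0) ⟩
    h 0 + L                ≡⟨ landingCols-applyUpTo k h (λ i → s≤s (columnHeight-antitone rs (suc i)))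
                                                        (λ i → s≤s (stair (suc i))) ⟩
    h k + k                ≡⟨ cong (_+ k) h-beyond ⟩
    suc k                  ∎
    where
      open ≤-Reasoning
      L : ℕ
      L = landingCols (applyUpTo h (suc k))

ψ₂-defined : ∀ rs → firstRow rs ≤ length rs + 3 →
  ψ₂ rs ≡ just (suc (suc (length rs)) ∷ shrinkRows rs)
ψ₂-defined rs j≤k+3 with firstRow rs ≤? length rs + 3
... | yes _ = refl
... | no j≰k+3 = ⊥-elim (j≰k+3 j≤k+3)

lemma4p2 : (rs : List ℕ) → IsPartition rs → StairStep rs → landing rs ≤ 2 →
    Σ (List ℕ) (λ μ → (ψ₂ rs ≡ just μ) × StairStep μ × landing μ ≤ 2)
lemma4p2 rs partition@(sorted , positive) stairStep landing≤2 =
  μ ,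
  ψ₂-defined rs (≤-trans j≤k+2 (+-monoʳ-≤ k (n≤1+n 2))) ,
  StairStep-∷-shrinkRows (suc k) sorted stair j≤2+k ,
  +-cancelˡ-≤ k (landing μ) 2 k+landing≤k+2
  where
    k : ℕ
    k = length rs
    μ : List ℕ
    μ = suc (suc k) ∷ shrinkRows rs
    stair : Stair (columnHeight rs)
    stair = StairStep⇒Stair rs sorted stairStep
    j≤k+2 : firstRow rs ≤ k + 2
    j≤k+2 = ≤-trans (firstRow≤length+landing rs partition stair) (+-monoʳ-≤ k landing≤2)
    j≤2+k : firstRow rs ≤ 2 + k
    j≤2+k = subst (firstRow rs ≤_) (+-comm k 2) j≤k+2
    k+landing≤k+2 : k + landing μ ≤ k + 2
    k+landing≤k+2 = begin
      k + landing μ                  ≡⟨ cong (_+ landing μ) (sym (columnHeight-zero rs positive)) ⟩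
      columnHeight rs 0 + landing μ  ≤⟨ landing-∷-shrinkRows (suc k) sorted stair j≤2+k ⟩
      2 + k                          ≡⟨ +-comm 2 k ⟩
      k + 2                          ∎
      where open ≤-Reasoning
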